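{- An involution-free rooted tree $(H,x)$ with at least three vertices contains a partial hardness gadget.
   Context: A rooted graph $(H,x)$ is a graph with a distinguished vertex $x$; it is involution-free if $H$ has no automorphism of order $2$ fixing $x$. For a path $Q$ and vertex $z$ adjacent to its last vertex, $Qz$ denotes $Q$ extended by that edge. A partial hardness gadget in a rooted graph $(H,x)$ is a tuple $(s,i,O,P)$ with $s\in V(H)$, $(\{i\},O)$ a partition of $\Gamma_H(s)$ (the neighbourhood of $s$), $P$ a path in $H$, such that $|O|$ is odd, $P$ is the unique shortest path from $x$ to $i$, $Ps$ is the unique shortest path from $x$ to $s$, and for each $o\in O$, $Pso$ is the unique shortest path from $x$ to $o$. -}

module Defs where

open import Data.Nat using (ℕ; zero; suc; _+_; _∸_; _≤_; _%_)
open import Data.Fin using (Fin)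
open import Data.Fin.Subset using (Subset; _∈_; _∉_; ∣_∣)
open import Data.Bool using (Bool; T)
open import Data.Unit using (⊤)
open import Data.List using (List; []; _∷_; length; _++_; [_])
open import Data.List.Relation.Unary.Unique.Propositional using (Unique)
open import Data.Product using (Σ; ∃; _×_; _,_)
open import Relation.Nullary using (¬_)
open import Relation.Binary.PropositionalEquality using (_≡_; _≢_)
open import Function.Bundles using (_⇔_)

record Graph (n : ℕ) : Set where
  field
    adj     : Fin n → Fin n → Bool
    adj-sym : ∀ u v → adj u v ≡ adj v u
    irrefl  : ∀ v → ¬ T (adj v v)

module _ {n : ℕ} (H : Graph n) where
  open Graph H

  Adj : Fin n → Fin n → Set
  Adj u v = T (adj u v)

  Chain : List (Fin n) → Set
  Chain []           = ⊤
  Chain (u ∷ [])     = ⊤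
  Chain (u ∷ v ∷ vs) = Adj u v × Chain (v ∷ vs)

  IsPath : List (Fin n) → Set
  IsPath p = (p ≢ []) × Chain p × Unique p

  PathFromTo : Fin n → Fin n → List (Fin n) → Set
  PathFromTo u v p = IsPath p × (Σ (List (Fin n)) λ r → p ≡ u ∷ r)
                              × (Σ (List (Fin n)) λ r → p ≡ r ++ [ v ])

  len : List (Fin n) → ℕ
  len p = length p ∸ 1

  UniqueShortestPath : Fin n → Fin n → List (Fin n) → Set
  UniqueShortestPath u v p =
    PathFromTo u v p
    × (∀ q → PathFromTo u v q → len p ≤ len q)
    × (∀ q → PathFromTo u v q → len q ≤ len p → q ≡ p)

  Connected : Set
  Connected = ∀ u v → ∃ λ p → PathFromTo u v p

  IsCycle : List (Fin n) → Set
  IsCycle p = IsPath p × (3 ≤ length p)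
            × (Σ (Fin n) λ a → Σ (Fin n) λ b → Σ (List (Fin n)) λ r →
                 (p ≡ a ∷ r ++ [ b ]) × Adj b a)

  Acyclic : Set
  Acyclic = ∀ p → ¬ IsCycle p

  IsTree : Set
  IsTree = Connected × Acyclic

  record Automorphism : Set where
    field
      σ       : Fin n → Fin n
      σ⁻¹     : Fin n → Fin n
      inv₁    : ∀ v → σ (σ⁻¹ v) ≡ v
      inv₂    : ∀ v → σ⁻¹ (σ v) ≡ v
      preserv : ∀ u v → adj (σ u) (σ v) ≡ adj u v

  OrderTwo : Automorphism → Set
  OrderTwo φ = (∀ v → σ (σ v) ≡ v) × (∃ λ v → σ v ≢ v)
    where open Automorphism φ

  InvolutionFree : Fin n → Set
  InvolutionFree x = ¬ (Σ Automorphism λ φ → OrderTwo φ × Automorphism.σ φ x ≡ x)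

  PartialHardnessGadget : Fin n → Fin n → Fin n → Subset n → List (Fin n) → Set
  PartialHardnessGadget x s i O P =
    -- ({i}, O) is a partition of Γ_H(s)
    Adj s i × i ∉ O × (∀ v → (v ∈ O) ⇔ (Adj s v × v ≢ i))
    × ∣ O ∣ % 2 ≡ 1
    × UniqueShortestPath x i P
    × UniqueShortestPath x s (P ++ [ s ])
    × (∀ o → o ∈ O → UniqueShortestPath x o (P ++ s ∷ [ o ]))

  HasPartialHardnessGadget : Fin n → Set
  HasPartialHardnessGadget x =
    Σ (Fin n) λ s → Σ (Fin n) λ i → Σ (Subset n) λ O → Σ (List (Fin n)) λ P →
      PartialHardnessGadget x s i O P

-- Walk down from the root x along a path x … u y, moving on to x … u z w whenever some
-- neighbour z of u off the path has a neighbour w ≠ u. Paths have at most n vertices, so the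
-- walk stops, and then every neighbour of u off the path is a leaf. Two such leaves would be twins,
-- and swapping them is an involution fixing x; so y is the only one. Were u = x, the tree would
-- be the single edge x y. Hence u has a parent i, and (u, i, {y}, x … i) is a partial hardness
-- gadget: in a tree a path is the unique, hence shortest, path between its ends, since two
-- different paths would close a cycle.
module Submission where

open import Defs
open import Data.Nat using (ℕ; _≤_)
open import Data.Fin using (Fin)

open import Data.Nat using (zero; suc; _+_; _%_; z≤n; s≤s; _≤?_)
open import Data.Nat.Properties
  using (≤-trans; ≤-reflexive; +-suc; +-comm; +-monoˡ-≤; m≤m+n; 1+n≰n; ≰⇒>)
open import Data.Fin using (zero; suc) renaming (_<_ to _<ᶠ_)
open import Data.Fin.Properties using (_≟_; any?; pigeonhole)
open import Data.Fin.Permutation.Components using (transpose; transpose-inverse)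
open import Data.Fin.Subset using (⁅_⁆) renaming (_∈_ to _∈ₛ_)
open import Data.Fin.Subset.Properties using (x∈⁅y⁆⇔x≡y; x≢y⇒x∉⁅y⁆; ∣⁅x⁆∣≡1)
open import Data.Bool using (true; false; T)
open import Data.Bool.Properties using (T?)
open import Data.Unit using (tt)
open import Data.Empty using (⊥; ⊥-elim)
open import Data.List
  using (List; []; _∷_; _++_; [_]; _∷ʳ_; length; reverse; lookup; head; initLast; _∷ʳ′_)
open import Data.List.Properties
  using ( ∷-injectiveʳ; ++-assoc; ++-conicalʳ; ∷ʳ-++; ∷ʳ-injectiveˡ; ∷ʳ-injectiveʳ
        ; length-++; length-++-sucʳ; unfold-reverse; reverse-++)
open import Data.List.Membership.Propositional using (_∈_; _∉_; lose)
open import Data.List.Membership.Propositional.Properties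
  using (∈-++⁺ˡ; ∈-++⁺ʳ; ∈-++⁻; ∈-∃++; ∈-lookup)
open import Data.List.Relation.Unary.Any using (Any; here; there)
open import Data.List.Relation.Unary.Any.Properties using (reverse⁻)
open import Data.List.Relation.Unary.All using (All; []; _∷_)
import Data.List.Relation.Unary.All as All
open import Data.List.Relation.Unary.All.Properties using (++⁻ˡ; All¬⇒¬Any)
open import Data.List.Relation.Unary.AllPairs using ([]; _∷_)
import Data.List.Relation.Unary.First as First
open import Data.List.Relation.Unary.First.Properties using (toView)
open import Data.List.Relation.Unary.Unique.Propositional using (Unique)
open import Data.List.Relation.Unary.Unique.Propositional.Properties
  using (++⁺; Unique[x∷xs]⇒x∉xs)
open import Data.List.Relation.Binary.Disjoint.Propositional using (Disjoint)
import Data.List.Relation.Binary.Permutation.Setoid as Permutation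
import Data.List.Relation.Binary.Permutation.Setoid.Properties as PermutationProperties
open import Data.Maybe.Properties using (just-injective)
open import Data.Product using (∃; ∃₂; _×_; _,_; proj₂)
open import Data.Sum using (_⊎_; inj₁; inj₂; [_,_]′)
import Data.Sum as Sum
open import Function using (_∘_; case_of_)
open import Function.Bundles using (_⇔_; mk⇔; Equivalence)
open import Relation.Nullary using (¬_; yes; no)
open import Relation.Nullary.Decidable using (_×-dec_; ¬?; decidable-stable; toSum)
open import Relation.Unary using (Decidable)
open import Relation.Binary.PropositionalEquality
  using (_≡_; _≢_; refl; sym; trans; cong; subst; setoid; module ≡-Reasoning)

module _ {A : Set} where
  open Permutation (setoid A) using (↭-sym)
  open PermutationProperties (setoid A) using (Unique-resp-↭; ↭-reverse)

  ∷ʳ≢[] : ∀ xs {x : A} → xs ∷ʳ x ≢ []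
  ∷ʳ≢[] xs e with () ← ++-conicalʳ xs _ e

  length-∷ʳ : ∀ xs {x : A} → length (xs ∷ʳ x) ≡ suc (length xs)
  length-∷ʳ xs = trans (length-++ xs) (+-comm (length xs) 1)

  ∷ʳ⇒∈ : ∀ {xs} {v : A} → (∃ λ r → xs ≡ r ∷ʳ v) → v ∈ xs
  ∷ʳ⇒∈ (r , refl) = ∈-++⁺ʳ r (here refl)

  ∷ʳ-tail : ∀ {a b : A} {xs v} → (∃ λ r → a ∷ b ∷ xs ≡ r ∷ʳ v) → ∃ λ r → b ∷ xs ≡ r ∷ʳ v
  ∷ʳ-tail (_ ∷ r , e) = r , ∷-injectiveʳ e

  ∉-∷ʳ : ∀ {xs} {v x : A} → v ∉ xs → v ≢ x → v ∉ xs ∷ʳ x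
  ∉-∷ʳ {xs} v∉xs v≢x v∈ with ∈-++⁻ xs v∈
  ... | inj₁ v∈xs       = v∉xs v∈xs
  ... | inj₂ (here v≡x) = v≢x v≡x

  Unique-++⁻ˡ : ∀ xs {ys : List A} → Unique (xs ++ ys) → Unique xs
  Unique-++⁻ˡ []       _        = []
  Unique-++⁻ˡ (x ∷ xs) (x∉ ∷ u) = ++⁻ˡ xs x∉ ∷ Unique-++⁻ˡ xs u

  Unique-++⁻-disjoint : ∀ xs {ys : List A} → Unique (xs ++ ys) → Disjoint xs ys
  Unique-++⁻-disjoint (x ∷ xs) (x∉ ∷ _) (here refl  , v∈ys) = All.lookup x∉ (∈-++⁺ʳ xs v∈ys) refl
  Unique-++⁻-disjoint (x ∷ xs) (_ ∷ u)  (there v∈xs , v∈ys) = Unique-++⁻-disjoint xs u (v∈xs , v∈ys)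

  Unique-prefix : ∀ xs {w : A} {ys} → Unique (xs ++ w ∷ ys) → Unique (xs ∷ʳ w)
  Unique-prefix xs {w} {ys} u = Unique-++⁻ˡ (xs ∷ʳ w) (subst Unique (sym (∷ʳ-++ xs w ys)) u)

  Unique-∷ʳ : ∀ {xs} {x : A} → Unique xs → x ∉ xs → Unique (xs ∷ʳ x)
  Unique-∷ʳ u x∉xs = ++⁺ u ([] ∷ []) λ { (x∈xs , here refl) → x∉xs x∈xs }

  Unique-reverse : ∀ {xs : List A} → Unique xs → Unique (reverse xs)
  Unique-reverse {xs} = Unique-resp-↭ (↭-sym (↭-reverse xs))

  lookup-injective : ∀ {xs : List A} → Unique xs → ∀ {i j} → i <ᶠ j → lookup xs i ≢ lookup xs j
  lookup-injective {_ ∷ xs} (x∉ ∷ _) {zero}  {suc j} _         = All.lookup x∉ (∈-lookup j)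
  lookup-injective {_ ∷ xs} (_ ∷ u)  {suc i} {suc j} (s≤s i<j) = lookup-injective u i<j

  split-at-first : ∀ {P : A → Set} → Decidable P → ∀ {xs} → Any P xs →
                   ∃₂ λ γ w → ∃ λ δ → xs ≡ γ ++ w ∷ δ × All (¬_ ∘ P) γ × P w
  split-at-first {P} P? {xs} some with First.first (Sum.swap ∘ toSum ∘ P?) xs
  ... | inj₂ none  = ⊥-elim (All¬⇒¬Any none some)
  ... | inj₁ first = split (toView first)
    where
    split : ∀ {zs} → First.FirstView (¬_ ∘ P) P zs →
            ∃₂ λ γ w → ∃ λ δ → zs ≡ γ ++ w ∷ δ × All (¬_ ∘ P) γ × P w
    split (First._++_∷_ γ∉ w∈ δ) = _ , _ , δ , refl , γ∉ , w∈

Unique⇒length≤ : ∀ {n} {xs : List (Fin n)} → Unique xs → length xs ≤ n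
Unique⇒length≤ {n} {xs} u = decidable-stable (length xs ≤? n) λ ≰n →
  let i , j , i<j , same = pigeonhole (≰⇒> ≰n) (lookup xs) in lookup-injective u i<j same

fresh : ∀ {n} → 3 ≤ n → (a b : Fin n) → ∃ λ t → t ≢ a × t ≢ b
fresh (s≤s (s≤s (s≤s _))) zero          zero          = suc zero       , (λ ()) , (λ ())
fresh (s≤s (s≤s (s≤s _))) zero          (suc zero)    = suc (suc zero) , (λ ()) , (λ ())
fresh (s≤s (s≤s (s≤s _))) zero          (suc (suc _)) = suc zero       , (λ ()) , (λ ())
fresh (s≤s (s≤s (s≤s _))) (suc zero)    zero          = suc (suc zero) , (λ ()) , (λ ())
fresh (s≤s (s≤s (s≤s _))) (suc (suc _)) zero          = suc zero       , (λ ()) , (λ ())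
fresh (s≤s (s≤s (s≤s _))) (suc _)       (suc _)       = zero           , (λ ()) , (λ ())

module Paths {n} (H : Graph n) where
  open Graph H

  Adj-sym : ∀ {u v} → Adj H u v → Adj H v u
  Adj-sym {u} {v} = subst T (adj-sym u v)

  Adj⇒≢ : ∀ {u v} → Adj H u v → u ≢ v
  Adj⇒≢ u~v refl = irrefl _ u~v

  Chain-prefix : ∀ xs {w ys} → Chain H (xs ++ w ∷ ys) → Chain H (xs ∷ʳ w)
  Chain-prefix []           _         = tt
  Chain-prefix (x ∷ [])     (x~w , _) = x~w , tt
  Chain-prefix (x ∷ y ∷ xs) (x~y , c) = x~y , Chain-prefix (y ∷ xs) c

  Chain-join : ∀ xs {w ys} → Chain H (xs ∷ʳ w) → Chain H (w ∷ ys) → Chain H (xs ++ w ∷ ys)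
  Chain-join []           _          c = c
  Chain-join (x ∷ [])     (x~w , _)  c = x~w , c
  Chain-join (x ∷ y ∷ xs) (x~y , c₁) c = x~y , Chain-join (y ∷ xs) c₁ c

  Chain-∷ʳ : ∀ xs {y z} → Chain H (xs ∷ʳ y) → Adj H y z → Chain H (xs ∷ʳ y ∷ʳ z)
  Chain-∷ʳ xs {y} {z} c y~z = subst (Chain H) (sym (∷ʳ-++ xs y [ z ])) (Chain-join xs c (y~z , tt))

  Chain-last : ∀ xs {y z} → Chain H (xs ∷ʳ y ∷ʳ z) → Adj H y z
  Chain-last []            (y~z , _)     = y~z
  Chain-last (x ∷ [])      (_ , y~z , _) = y~z
  Chain-last (x ∷ x′ ∷ xs) (_ , c)       = Chain-last (x′ ∷ xs) c

  Chain-reverse : ∀ xs → Chain H xs → Chain H (reverse xs)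
  Chain-reverse []           _         = tt
  Chain-reverse (x ∷ [])     _         = tt
  Chain-reverse (x ∷ y ∷ xs) (x~y , c) =
    subst (Chain H) (sym reverse-x∷y∷xs)
      (Chain-∷ʳ (reverse xs) (subst (Chain H) (unfold-reverse y xs) (Chain-reverse (y ∷ xs) c))
                (Adj-sym x~y))
    where
    reverse-x∷y∷xs : reverse (x ∷ y ∷ xs) ≡ reverse xs ∷ʳ y ∷ʳ x
    reverse-x∷y∷xs = trans (unfold-reverse x (y ∷ xs)) (cong (_∷ʳ x) (unfold-reverse y xs))

  edge-path : ∀ {u v} → Adj H u v → PathFromTo H u v (u ∷ [ v ])
  edge-path {u} u~v =
    ((λ ()) , (u~v , tt) , (Adj⇒≢ u~v ∷ []) ∷ [] ∷ []) , (_ , refl) , ([ u ] , refl)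

  IsPath-tail : ∀ {a b xs} → IsPath H (a ∷ b ∷ xs) → IsPath H (b ∷ xs)
  IsPath-tail (_ , (_ , c) , _ ∷ u) = (λ ()) , c , u

  path-start∈ : ∀ {u v p} → PathFromTo H u v p → u ∈ p
  path-start∈ (_ , (_ , refl) , _) = here refl

  path-end∈ : ∀ {u v p} → PathFromTo H u v p → v ∈ p
  path-end∈ (_ , _ , end) = ∷ʳ⇒∈ end

  path-last-edge : ∀ Q {a u v} → PathFromTo H a v (Q ∷ʳ u ∷ʳ v) → Adj H u v
  path-last-edge Q ((_ , c , _) , _) = Chain-last Q c

  path-end∉ : ∀ Q {u v} → PathFromTo H u v (Q ∷ʳ v) → v ∉ Q
  path-end∉ Q ((_ , _ , uniq) , _) v∈Q = Unique-++⁻-disjoint Q uniq (v∈Q , here refl)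

  path-length≤ : ∀ {u v p} → PathFromTo H u v p → length p ≤ n
  path-length≤ ((_ , _ , uniq) , _) = Unique⇒length≤ uniq

  path-extend : ∀ Q {u v z} → PathFromTo H u v (Q ∷ʳ v) → Adj H v z → z ∉ Q ∷ʳ v →
                PathFromTo H u z (Q ∷ʳ v ∷ʳ z)
  path-extend Q {z = z} ((_ , c , uniq) , (r , starts) , _) v~z z∉ =
    (∷ʳ≢[] (Q ∷ʳ _) , Chain-∷ʳ Q c v~z , Unique-∷ʳ uniq z∉) ,
    (r ∷ʳ z , cong (_∷ʳ z) starts) , (Q ∷ʳ _ , refl)

  path-prefix : ∀ Q {u v w} R → PathFromTo H u v (Q ++ w ∷ R) → PathFromTo H u w (Q ∷ʳ w)
  path-prefix Q R ((_ , c , uniq) , (_ , starts) , _) =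
    (∷ʳ≢[] Q , Chain-prefix Q c , Unique-prefix Q uniq) , prefix-starts Q starts , (Q , refl)
    where
    prefix-starts : ∀ {u w r} Q → Q ++ w ∷ R ≡ u ∷ r → ∃ λ r′ → Q ∷ʳ w ≡ u ∷ r′
    prefix-starts []      refl = [] , refl
    prefix-starts (_ ∷ Q) refl = Q ∷ʳ _ , refl

  path-init : ∀ Q {u w v} → PathFromTo H u v (Q ∷ʳ w ∷ʳ v) → PathFromTo H u w (Q ∷ʳ w)
  path-init Q {u} {w} {v} p = path-prefix Q [ v ] (subst (PathFromTo H u v) (∷ʳ-++ Q w [ v ]) p)

  connected⇒neighbour : Connected H → ∀ {a t} → t ≢ a → ∃ λ b → Adj H a b
  connected⇒neighbour connected {a} {t} t≢a = neighbour (proj₂ (connected a t))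
    where
    neighbour : ∀ {p} → PathFromTo H a t p → ∃ λ b → Adj H a b
    neighbour path@(_ , ([] , refl) , _) with path-end∈ path
    ... | here t≡a = ⊥-elim (t≢a t≡a)
    neighbour ((_ , (a~b , _) , _) , (b ∷ _ , refl) , _) = b , a~b

  isolated-edge : Connected H → ∀ {a b} → (∀ z → Adj H a z → z ≡ b) → (∀ z → Adj H b z → z ≡ a) →
                  ∀ t → t ≡ a ⊎ t ≡ b
  isolated-edge connected {a} {b} a-only b-only t = on-path (proj₂ (connected a t))
    where
    on-path : ∀ {p} → PathFromTo H a t p → t ≡ a ⊎ t ≡ b
    on-path path@(_ , ([] , refl) , _) with path-end∈ path
    ... | here t≡a = inj₁ t≡a
    on-path path@((_ , (a~c , _) , _) , (c ∷ [] , refl) , _) with path-end∈ path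
    ... | here t≡a         = inj₁ t≡a
    ... | there (here t≡c) = inj₂ (trans t≡c (a-only c a~c))
    on-path ((_ , (a~c , c~d , _) , (_ ∷ a≢d ∷ _) ∷ _) , (c ∷ d ∷ _ , refl) , _) with a-only c a~c
    ... | refl = ⊥-elim (a≢d (sym (b-only d c~d)))

  closed-path⇒cycle : ∀ {a b} r → IsPath H (a ∷ r ∷ʳ b) → 1 ≤ length r → Adj H b a →
                      IsCycle H (a ∷ r ∷ʳ b)
  closed-path⇒cycle r path 1≤r b~a =
    path , s≤s (subst (2 ≤_) (sym (length-++ r)) (+-monoˡ-≤ 1 1≤r)) , _ , _ , r , refl , b~a

  meeting⇒cycle : ∀ {a c w} α γ {β δ} → IsPath H (a ∷ α ++ w ∷ β) → IsPath H (a ∷ c ∷ γ ++ w ∷ δ) →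
                  Disjoint α (c ∷ γ) → IsCycle H (a ∷ (α ++ w ∷ reverse γ) ∷ʳ c)
  meeting⇒cycle {a} {c} {w} α γ (_ , chain₁ , unique₁)
                (_ , (a~c , chain₂) , unique₂@(_ ∷ unique₂′)) α#γ =
    closed-path⇒cycle (α ++ w ∷ reverse γ) (subst (IsPath H) shape ((λ ()) , chain , unique))
      (subst (1 ≤_) (sym (length-++-sucʳ α w _)) (s≤s z≤n)) (Adj-sym a~c)
    where
    back : List (Fin n)
    back = w ∷ reverse (c ∷ γ)
    reverse-back : reverse (c ∷ γ ∷ʳ w) ≡ back
    reverse-back = reverse-++ (c ∷ γ) [ w ]
    chain : Chain H ((a ∷ α) ++ back)
    chain = Chain-join (a ∷ α) (Chain-prefix (a ∷ α) chain₁)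
              (subst (Chain H) reverse-back (Chain-reverse _ (Chain-prefix (c ∷ γ) chain₂)))
    disjoint : Disjoint (a ∷ α) back
    disjoint (v∈aα      , here refl) = Unique-++⁻-disjoint (a ∷ α) unique₁ (v∈aα , here refl)
    disjoint (here refl , there v∈)  = Unique[x∷xs]⇒x∉xs unique₂ (∈-++⁺ˡ (reverse⁻ {xs = c ∷ γ} v∈))
    disjoint (there v∈α , there v∈)  = α#γ (v∈α , reverse⁻ {xs = c ∷ γ} v∈)
    unique : Unique ((a ∷ α) ++ back)
    unique = ++⁺ (Unique-++⁻ˡ (a ∷ α) unique₁)
               (subst Unique reverse-back (Unique-reverse (Unique-prefix (c ∷ γ) unique₂′))) disjoint
    shape : (a ∷ α) ++ back ≡ a ∷ (α ++ w ∷ reverse γ) ∷ʳ c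
    shape = cong (a ∷_) (trans (cong (λ r → α ++ w ∷ r) (unfold-reverse c γ))
                               (sym (++-assoc α (w ∷ reverse γ) [ c ])))

module TreePaths {n} {H : Graph n} (acyclic : Acyclic H) where
  open Paths H
  open import Data.List.Membership.DecPropositional (_≟_ {n}) using (_∈?_)

  acyclic⇒¬meeting : ∀ {a w} α γ {β δ} → IsPath H (a ∷ α ++ w ∷ β) → IsPath H (a ∷ γ ++ w ∷ δ) →
                     Disjoint α γ → head (α ++ w ∷ β) ≢ head (γ ++ w ∷ δ) → ⊥
  acyclic⇒¬meeting []      []      _ _ _ heads≢ = heads≢ refl
  acyclic⇒¬meeting α       (_ ∷ γ) pα pγ α#γ _ = acyclic _ (meeting⇒cycle α γ pα pγ α#γ)
  acyclic⇒¬meeting (_ ∷ α) []      pα pγ _   _ = acyclic _ (meeting⇒cycle [] α pγ pα λ ())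

  acyclic⇒branches-disjoint : ∀ {a As Bs} → IsPath H (a ∷ As) → IsPath H (a ∷ Bs) →
                              head As ≢ head Bs → Disjoint As Bs
  acyclic⇒branches-disjoint {As = As} pathA pathB heads≢ (v∈As , v∈Bs)
    with split-at-first (_∈? As) (lose v∈Bs v∈As)
  ... | γ , w , δ , refl , γ∉As , w∈As with ∈-∃++ w∈As
  ...   | α , β , refl = acyclic⇒¬meeting α γ pathA pathB α#γ heads≢
    where
    α#γ : Disjoint α γ
    α#γ (v∈α , v∈γ) = All.lookup γ∉As v∈γ (∈-++⁺ˡ v∈α)

  acyclic⇒path-unique : ∀ {u v p q} → PathFromTo H u v p → PathFromTo H u v q → p ≡ q
  acyclic⇒path-unique (pathp , (r , refl) , endp) (pathq , (r′ , refl) , endq) =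
    cong (_ ∷_) (same-tail r r′ pathp pathq endp endq)
    where
    same-tail : ∀ {a v} As Bs → IsPath H (a ∷ As) → IsPath H (a ∷ Bs) →
                (∃ λ r → a ∷ As ≡ r ∷ʳ v) → (∃ λ r → a ∷ Bs ≡ r ∷ʳ v) → As ≡ Bs
    same-tail []       []      _ _ _ _ = refl
    same-tail []       (_ ∷ _) _ (_ , _ , uniqueB) endA endB with ∷ʳ⇒∈ endA
    ... | here refl = ⊥-elim (Unique[x∷xs]⇒x∉xs uniqueB (∷ʳ⇒∈ (∷ʳ-tail endB)))
    same-tail (_ ∷ _)  []      (_ , _ , uniqueA) _ endA endB with ∷ʳ⇒∈ endB
    ... | here refl = ⊥-elim (Unique[x∷xs]⇒x∉xs uniqueA (∷ʳ⇒∈ (∷ʳ-tail endA)))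
    same-tail (b ∷ As) (c ∷ Bs) pathA pathB endA endB with b ≟ c
    ... | yes refl = cong (b ∷_) (same-tail As Bs (IsPath-tail pathA) (IsPath-tail pathB)
                                    (∷ʳ-tail endA) (∷ʳ-tail endB))
    ... | no b≢c   = ⊥-elim (acyclic⇒branches-disjoint pathA pathB (b≢c ∘ just-injective)
                                                       (∷ʳ⇒∈ (∷ʳ-tail endA) , ∷ʳ⇒∈ (∷ʳ-tail endB)))

  acyclic⇒uniqueShortestPath : ∀ {u v p} → PathFromTo H u v p → UniqueShortestPath H u v p
  acyclic⇒uniqueShortestPath p =
    p , (λ _ q → ≤-reflexive (cong (len H) (acyclic⇒path-unique p q))) ,
        (λ _ q _ → acyclic⇒path-unique q p)

  -- Otherwise x … o s would be a second path to s.
  acyclic⇒neighbour-on-path : ∀ Q {x u s o} → PathFromTo H x s (Q ∷ʳ u ∷ʳ s) → o ∈ Q ∷ʳ u →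
                              Adj H o s → o ≡ u
  acyclic⇒neighbour-on-path Q {x} {u} {s} {o} path o∈ o~s with ∈-∃++ o∈
  ... | A , B , split =
    ∷ʳ-injectiveʳ A Q (∷ʳ-injectiveˡ (A ∷ʳ o) (Q ∷ʳ u) (acyclic⇒path-unique via-o path))
    where
    to-o : PathFromTo H x o (A ∷ʳ o)
    to-o = path-prefix A (B ∷ʳ s)
             (subst (PathFromTo H x s) (trans (cong (_∷ʳ s) split) (++-assoc A (o ∷ B) [ s ])) path)
    s∉ : s ∉ A ∷ʳ o
    s∉ s∈ = path-end∉ (Q ∷ʳ u) path (subst (s ∈_) (trans (∷ʳ-++ A o B) (sym split)) (∈-++⁺ˡ s∈))
    via-o : PathFromTo H x s (A ∷ʳ o ∷ʳ s)
    via-o = path-extend A to-o o~s s∉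

transpose-ˡ : ∀ {n} (a b : Fin n) → transpose a b a ≡ b
transpose-ˡ a b with a ≟ a
... | yes _   = refl
... | no a≢a = ⊥-elim (a≢a refl)

transpose-ʳ : ∀ {n} (a b : Fin n) → transpose a b b ≡ a
transpose-ʳ a b with b ≟ a
... | yes b≡a = b≡a
... | no _ with b ≟ b
...   | yes _   = refl
...   | no b≢b = ⊥-elim (b≢b refl)

transpose-fix : ∀ {n} {a b v : Fin n} → v ≢ a → v ≢ b → transpose a b v ≡ v
transpose-fix {a = a} {b} {v} v≢a v≢b with v ≟ a
... | yes v≡a = ⊥-elim (v≢a v≡a)
... | no _ with v ≟ b
...   | yes v≡b = ⊥-elim (v≢b v≡b)
...   | no _    = refl

transpose-involutive : ∀ {n} (a b v : Fin n) → transpose a b (transpose a b v) ≡ v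
transpose-involutive a b v with v ≟ a
... | yes refl = transpose-ʳ a b
... | no v≢a with v ≟ b
...   | yes refl = transpose-ˡ a v
...   | no v≢b   = transpose-fix v≢a v≢b

T-⇔⇒≡ : ∀ {p q} → T p ⇔ T q → p ≡ q
T-⇔⇒≡ {false} {false} _ = refl
T-⇔⇒≡ {false} {true}  h = ⊥-elim (Equivalence.from h tt)
T-⇔⇒≡ {true}  {false} h = ⊥-elim (Equivalence.to h tt)
T-⇔⇒≡ {true}  {true}  _ = refl

module Involutions {n} (H : Graph n) where
  open Graph H

  Twins : Fin n → Fin n → Set
  Twins a b = ∀ w → adj a w ≡ adj b w

  transpose-twins : ∀ {a b} → Twins a b → ∀ v → Twins (transpose a b v) v
  transpose-twins {a} {b} a≈b v z with v ≟ a
  ... | yes refl = sym (a≈b z)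
  ... | no _ with v ≟ b
  ...   | yes refl = a≈b z
  ...   | no _     = refl

  twins⇒automorphism : ∀ {a b} → Twins a b → Automorphism H
  twins⇒automorphism {a} {b} a≈b = record
    { σ       = transpose a b
    ; σ⁻¹     = transpose b a
    ; inv₁    = λ _ → transpose-inverse a b
    ; inv₂    = λ _ → transpose-inverse b a
    ; preserv = preserves
    }
    where
    open ≡-Reasoning
    τ = transpose a b
    preserves : ∀ u v → adj (τ u) (τ v) ≡ adj u v
    preserves u v = begin
      adj (τ u) (τ v) ≡⟨ transpose-twins a≈b u (τ v) ⟩
      adj u (τ v)     ≡⟨ adj-sym u (τ v) ⟩
      adj (τ v) u     ≡⟨ transpose-twins a≈b v u ⟩
      adj v u         ≡⟨ adj-sym v u ⟩
      adj u v         ∎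

  involutionFree⇒¬twins : ∀ {x a b} → InvolutionFree H x → a ≢ b → x ≢ a → x ≢ b → ¬ Twins a b
  involutionFree⇒¬twins {x} {a} {b} invFree a≢b x≢a x≢b a≈b =
    invFree (twins⇒automorphism a≈b , (transpose-involutive a b , a , a-moves) , transpose-fix x≢a x≢b)
    where
    a-moves : transpose a b a ≢ a
    a-moves moved = a≢b (trans (sym moved) (transpose-ˡ a b))

  pendant-siblings⇒twins : ∀ {a b u} → Adj H a u → Adj H b u →
                           (∀ w → Adj H a w → w ≡ u) → (∀ w → Adj H b w → w ≡ u) → Twins a b
  pendant-siblings⇒twins {a} {b} a~u b~u a-pendant b-pendant w =
    T-⇔⇒≡ (mk⇔ (λ a~w → subst (Adj H b) (sym (a-pendant w a~w)) b~u)
               (λ b~w → subst (Adj H a) (sym (b-pendant w b~w)) a~u))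

module Descent {n} (H : Graph n) (x : Fin n) (3≤n : 3 ≤ n) (connected : Connected H)
               (acyclic : Acyclic H) (invFree : InvolutionFree H x) where
  open Graph H
  open Paths H
  open TreePaths acyclic
  open Involutions H
  open import Data.List.Membership.DecPropositional (_≟_ {n}) using (_∈?_)

  LeavesBelow : List (Fin n) → Fin n → Set
  LeavesBelow P u = ∀ z → Adj H u z → z ∉ P → ∀ w → Adj H z w → w ≡ u

  deepen-or-leaves : ∀ P {u} → PathFromTo H x u (P ∷ʳ u) →
                     (∃₂ λ z w → PathFromTo H x w (P ∷ʳ u ∷ʳ z ∷ʳ w)) ⊎ LeavesBelow P u
  deepen-or-leaves P {u} to-u
    with any? (λ z → T? (adj u z) ×-dec ¬? (z ∈? P) ×-dec
                     any? (λ w → T? (adj z w) ×-dec ¬? (w ≟ u)))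
  ... | yes (z , u~z , z∉P , w , z~w , w≢u) = inj₁ (z , w , path-extend (P ∷ʳ u) to-z z~w w∉)
    where
    to-z : PathFromTo H x z (P ∷ʳ u ∷ʳ z)
    to-z = path-extend P to-u u~z (∉-∷ʳ z∉P (Adj⇒≢ u~z ∘ sym))
    w∉ : w ∉ P ∷ʳ u ∷ʳ z
    w∉ = ∉-∷ʳ (λ w∈ → w≢u (acyclic⇒neighbour-on-path P to-z w∈ (Adj-sym z~w))) (Adj⇒≢ z~w ∘ sym)
  ... | no ¬deeper = inj₂ λ z u~z z∉P w z~w →
    decidable-stable (w ≟ u) λ w≢u → ¬deeper (z , u~z , z∉P , w , z~w , w≢u)

  -- Two leaves below u could be swapped by an involution fixing x.
  leaves⇒only-child : ∀ P {u y} → PathFromTo H x y (P ∷ʳ u ∷ʳ y) → LeavesBelow P u →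
                      ∀ z → Adj H u z → z ∉ P → z ≡ y
  leaves⇒only-child P {u} {y} to-y leaves z u~z z∉P = decidable-stable (z ≟ y) λ z≢y →
    involutionFree⇒¬twins invFree z≢y (off-path (∉-∷ʳ z∉P (Adj⇒≢ u~z ∘ sym))) (off-path y∉)
      (pendant-siblings⇒twins (Adj-sym u~z) (Adj-sym u~y)
                              (leaves z u~z z∉P) (leaves y u~y (y∉ ∘ ∈-++⁺ˡ)))
    where
    u~y = path-last-edge P to-y
    y∉ = path-end∉ (P ∷ʳ u) to-y
    off-path : ∀ {v} → v ∉ P ∷ʳ u → x ≢ v
    off-path v∉ refl = v∉ (path-start∈ (path-init P to-y))

  gadget : ∀ I {i u y} → PathFromTo H x y (I ∷ʳ i ∷ʳ u ∷ʳ y) →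
           (∀ z → Adj H u z → z ∉ I ∷ʳ i → z ≡ y) → PartialHardnessGadget H x u i ⁅ y ⁆ (I ∷ʳ i)
  gadget I {i} {u} {y} to-y only-y =
    Adj-sym (path-last-edge I to-u) , x≢y⇒x∉⁅y⁆ i≢y , partition , cong (_% 2) (∣⁅x⁆∣≡1 y) ,
    usp to-i , usp to-u , λ _ → below
    where
    usp = acyclic⇒uniqueShortestPath
    to-u = path-init (I ∷ʳ i) to-y
    to-i = path-init I to-u
    i≢y : i ≢ y
    i≢y i≡y = path-end∉ (I ∷ʳ i ∷ʳ u) to-y (∈-++⁺ˡ (subst (_∈ I ∷ʳ i) i≡y (path-end∈ to-i)))
    partition : ∀ v → (v ∈ₛ ⁅ y ⁆) ⇔ (Adj H u v × v ≢ i)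
    partition v = mk⇔
      (λ v∈ → case Equivalence.to x∈⁅y⁆⇔x≡y v∈ of λ where
                 refl → path-last-edge (I ∷ʳ i) to-y , i≢y ∘ sym)
      (λ (u~v , v≢i) → Equivalence.from x∈⁅y⁆⇔x≡y
         (only-y v u~v λ v∈ → v≢i (acyclic⇒neighbour-on-path I to-u v∈ (Adj-sym u~v))))
    below : ∀ {o} → o ∈ₛ ⁅ y ⁆ → UniqueShortestPath H x o ((I ∷ʳ i) ++ u ∷ [ o ])
    below o∈ with refl ← Equivalence.to x∈⁅y⁆⇔x≡y o∈ =
      usp (subst (PathFromTo H x y) (∷ʳ-++ (I ∷ʳ i) u [ y ]) to-y)

  leaves⇒gadget : ∀ P {u y} → PathFromTo H x y (P ∷ʳ u ∷ʳ y) → LeavesBelow P u →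
                  HasPartialHardnessGadget H x
  leaves⇒gadget P {u} {y} to-y leaves with initLast P
  ... | [] with t , t≢u , t≢y ← fresh 3≤n u y =
    ⊥-elim ([ t≢u , t≢y ]′ (isolated-edge connected (λ z u~z → only-child z u~z λ ())
                                                    (leaves y (path-last-edge [] to-y) λ ()) t))
    where only-child = leaves⇒only-child [] to-y leaves
  ... | I ∷ʳ′ i = u , i , ⁅ y ⁆ , I ∷ʳ i , gadget I to-y (leaves⇒only-child (I ∷ʳ i) to-y leaves)

  descend : ∀ fuel P {u y} → PathFromTo H x y (P ∷ʳ u ∷ʳ y) → n ≤ fuel + length P →
            HasPartialHardnessGadget H x
  descend zero P to-y n≤∣P∣ = ⊥-elim (1+n≰n (≤-trans ∣Pu∣≤n n≤∣P∣))
    where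
    ∣Pu∣≤n : suc (length P) ≤ n
    ∣Pu∣≤n = subst (_≤ n) (length-∷ʳ P) (path-length≤ (path-init P to-y))
  descend (suc fuel) P {u} to-y n≤ with deepen-or-leaves P (path-init P to-y)
  ... | inj₁ (_ , _ , to-w) = descend fuel (P ∷ʳ u) to-w (subst (n ≤_) shift n≤)
    where
    shift : suc fuel + length P ≡ fuel + length (P ∷ʳ u)
    shift = trans (sym (+-suc fuel (length P))) (cong (fuel +_) (sym (length-∷ʳ P)))
  ... | inj₂ leaves = leaves⇒gadget P to-y leaves

  root-edge : ∃ λ y → PathFromTo H x y ([] ∷ʳ x ∷ʳ y)
  root-edge =
    let t , t≢x , _ = fresh 3≤n x x
        y , x~y     = connected⇒neighbour connected t≢x
    in  y , edge-path x~y

lemma7p1 : (n : ℕ) → 3 ≤ n → (H : Graph n) → (x : Fin n) →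
           IsTree H → InvolutionFree H x → HasPartialHardnessGadget H x
lemma7p1 n 3≤n H x (connected , acyclic) invFree = descend n [] (proj₂ root-edge) (m≤m+n n 0)
  where open Descent H x 3≤n connected acyclic invFree
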